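{- In a $\mathrm{PS4}$ model, if $xSy$, then for every formula $\phi$, if $v(\phi,x)\in\{1,0\}$ then $v(\phi,y)=v(\phi,x)$.
   Context: A $\mathrm{PS4}$ frame is $\langle W,R,S\rangle$ with $W$ nonempty and $R,S$ binary relations on $W$ such that: $S$ is reflexive; $R$ is reflexive; (Pseudo-Transitivity) if $xRy$ and $yRz$ then there is $w$ with $xRw$ and $zSw$; (Forth) if $xRy$ and $xSz$ then there is $w$ with $zRw$ and $ySw$; (Back) if $xSz$ and $zRw$ then there is $y$ with $xRy$ and $ySw$. A $\mathrm{PS4}$ model adds $v$ from (point, formula) pairs to $\{1,*,0\}$ obeying Strong Kleene clauses: $\neg\phi$ is 1 (0) iff $\phi$ is 0 (1); $\phi\land\psi$ is 1 iff both are 1, 0 iff one is 0; $\phi\lor\psi$ is 1 iff one is 1, 0 iff both are 0; $v(\Box\phi,x)=1$ iff $v(\phi,y)=1$ for all $y$ with $xRy$, and $v(\Box\phi,x)=0$ iff $v(\phi,y)=0$ for some $y$ with $xRy$; and ($S$ information preservation) if $xSy$ then for every atom $p$, if $v(p,x)\in\{1,0\}$ then $v(p,y)=v(p,x)$. -}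

module Defs where

open import Data.Product using (Σ; _×_; _,_; ∃)
open import Data.Sum using (_⊎_)
open import Relation.Binary.PropositionalEquality using (_≡_)
open import Relation.Binary.Core using (Rel)
open import Relation.Binary.Definitions using (Reflexive)

data V3 : Set where
  one star zero : V3

Classical : V3 → Set
Classical a = (a ≡ one) ⊎ (a ≡ zero)

_⇔_ : Set → Set → Set
A ⇔ B = (A → B) × (B → A)

data Form (Atom : Set) : Set where
  atom : Atom → Form Atom
  ¬'_  : Form Atom → Form Atom
  _∧'_ : Form Atom → Form Atom → Form Atom
  _∨'_ : Form Atom → Form Atom → Form Atom
  □_   : Form Atom → Form Atom

record PS4Frame : Set₁ where
  field
    W    : Set
    w₀   : W
    R    : Rel W _
    S    : Rel W _
    S-refl : Reflexive S
    R-refl : Reflexive R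
    pseudoTrans : ∀ {x y z} → R x y → R y z → ∃ λ w → R x w × S z w
    forth : ∀ {x y z} → R x y → S x z → ∃ λ w → R z w × S y w
    back  : ∀ {x z w} → S x z → R z w → ∃ λ y → R x y × S y w

record PS4Model (Atom : Set) : Set₁ where
  field
    frame : PS4Frame
  open PS4Frame frame public
  field
    v : W → Form Atom → V3
    neg-1 : ∀ x φ → (v x (¬' φ) ≡ one) ⇔ (v x φ ≡ zero)
    neg-0 : ∀ x φ → (v x (¬' φ) ≡ zero) ⇔ (v x φ ≡ one)
    and-1 : ∀ x φ ψ → (v x (φ ∧' ψ) ≡ one) ⇔ ((v x φ ≡ one) × (v x ψ ≡ one))
    and-0 : ∀ x φ ψ → (v x (φ ∧' ψ) ≡ zero) ⇔ ((v x φ ≡ zero) ⊎ (v x ψ ≡ zero))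
    or-1  : ∀ x φ ψ → (v x (φ ∨' ψ) ≡ one) ⇔ ((v x φ ≡ one) ⊎ (v x ψ ≡ one))
    or-0  : ∀ x φ ψ → (v x (φ ∨' ψ) ≡ zero) ⇔ ((v x φ ≡ zero) × (v x ψ ≡ zero))
    box-1 : ∀ x φ → (v x (□ φ) ≡ one) ⇔ (∀ y → R x y → v y φ ≡ one)
    box-0 : ∀ x φ → (v x (□ φ) ≡ zero) ⇔ (∃ λ y → R x y × (v y φ ≡ zero))
    S-pres : ∀ {x y} → S x y → ∀ p → Classical (v x (atom p)) → v y (atom p) ≡ v x (atom p)

{-# OPTIONS --safe #-}
-- By induction on φ, truth and falsity are each carried along S separately;
-- negation swaps the two. At □φ, truth at y is pulled back to x along
-- (Back), so every R-successor of y is S-above an R-successor of x; falsity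
-- at x is pushed to y along (Forth).
module Submission where

open import Defs
open import Data.Product using (_,_; proj₁; proj₂) renaming (map to map×)
open import Data.Sum using (inj₁; inj₂) renaming (map to map⊎)
open import Relation.Binary.PropositionalEquality using (_≡_; sym; trans)

module _ {Atom : Set} (M : PS4Model Atom) where
  open PS4Model M

  S-preserves-one  : ∀ φ {x y} → S x y → v x φ ≡ one  → v y φ ≡ one
  S-preserves-zero : ∀ φ {x y} → S x y → v x φ ≡ zero → v y φ ≡ zero

  S-preserves-one (atom p) s e = trans (S-pres s p (inj₁ e)) e
  S-preserves-one (¬' φ) {x} {y} s e =
    proj₂ (neg-1 y φ) (S-preserves-zero φ s (proj₁ (neg-1 x φ) e))
  S-preserves-one (φ ∧' ψ) {x} {y} s e =
    proj₂ (and-1 y φ ψ)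
      (map× (S-preserves-one φ s) (S-preserves-one ψ s) (proj₁ (and-1 x φ ψ) e))
  S-preserves-one (φ ∨' ψ) {x} {y} s e =
    proj₂ (or-1 y φ ψ)
      (map⊎ (S-preserves-one φ s) (S-preserves-one ψ s) (proj₁ (or-1 x φ ψ) e))
  S-preserves-one (□ φ) {x} {y} s e = proj₂ (box-1 y φ) φ-one-at-R-successor
    where
    φ-one-at-R-successor : ∀ w → R y w → v w φ ≡ one
    φ-one-at-R-successor w ryw with back s ryw
    ... | u , rxu , suw = S-preserves-one φ suw (proj₁ (box-1 x φ) e u rxu)

  S-preserves-zero (atom p) s e = trans (S-pres s p (inj₂ e)) e
  S-preserves-zero (¬' φ) {x} {y} s e =
    proj₂ (neg-0 y φ) (S-preserves-one φ s (proj₁ (neg-0 x φ) e))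
  S-preserves-zero (φ ∧' ψ) {x} {y} s e =
    proj₂ (and-0 y φ ψ)
      (map⊎ (S-preserves-zero φ s) (S-preserves-zero ψ s) (proj₁ (and-0 x φ ψ) e))
  S-preserves-zero (φ ∨' ψ) {x} {y} s e =
    proj₂ (or-0 y φ ψ)
      (map× (S-preserves-zero φ s) (S-preserves-zero ψ s) (proj₁ (or-0 x φ ψ) e))
  S-preserves-zero (□ φ) {x} {y} s e with proj₁ (box-0 x φ) e
  ... | u , rxu , φ-zero-at-u with forth rxu s
  ...   | w , ryw , suw = proj₂ (box-0 y φ) (w , ryw , S-preserves-zero φ suw φ-zero-at-u)

mainTheorem4 : {Atom : Set} (M : PS4Model Atom) →
    let open PS4Model M in
    ∀ {x y} → S x y → ∀ (φ : Form Atom) → Classical (v x φ) → v y φ ≡ v x φ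
mainTheorem4 M s φ (inj₁ e) = trans (S-preserves-one M φ s e) (sym e)
mainTheorem4 M s φ (inj₂ e) = trans (S-preserves-zero M φ s e) (sym e)
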